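{- Let $G$ be a finite simple connected graph and $r\ge 0$ an integer. Then $\mathcal{N}(G,r)$ has vertex set $V(G)$, and: if $r$ is even, its simplices are exactly the nonempty subsets of the sets $N_{r/2}[v]$ for $v\in V(G)$; if $r$ is odd, its simplices are exactly the singletons $\{v\}$, $v\in V(G)$, together with the nonempty subsets of the sets $N_{(r-1)/2}[v]\cup N_{(r-1)/2}[w]$ for edges $(v,w)\in E(G)$.
   Context: For a finite simple connected graph $G$ and a real number $r\ge 0$, the Čech complex $\mathcal{N}(G,r)$ is the simplicial complex with vertex set $V(G)$ in which a finite nonempty set $\sigma\subseteq V(G)$ is a simplex if and only if the closed balls of radius $\frac r2$ centered at the vertices of $\sigma$ have a common point, the balls being taken in the geometric realization of $G$ with the shortest path metric in which each edge is isometric to $[0,1]$. For $v\in V(G)$ and $s\ge 0$, $N_s[v]=\{w\in V(G): d(v,w)\le s\}$, where $d$ is the shortest path distance on $V(G)$.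
   Formalization: Points of the geometric realization of $G$ lying inside an edge are taken only at rational distance from the endpoints of that edge, rather than at every point of $[0,1]$. -}

module Defs where

open import Level using (0ℓ)
open import Data.Nat as ℕ using (ℕ; zero; suc)
open import Data.Fin using (Fin)
open import Data.Fin.Subset using (Subset; _∈_)
open import Data.Integer using (+_)
open import Data.Rational as ℚ using (ℚ; _/_; 0ℚ; 1ℚ; _-_)
open import Data.Product using (Σ; ∃; ∃-syntax; _×_; _,_)
open import Data.Sum using (_⊎_)
open import Relation.Nullary using (¬_)
open import Relation.Binary.PropositionalEquality using (_≡_)

Graph : ℕ → Set₁
Graph n = Fin n → Fin n → Set

-- Simple graph: no loops, symmetric edge relation (no multi-edges by construction).
record IsSimple {n : ℕ} (E : Graph n) : Set where
  field
    irrefl : ∀ v → ¬ E v v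
    sym    : ∀ {v w} → E v w → E w v

data Walk {n : ℕ} (E : Graph n) : Fin n → Fin n → ℕ → Set where
  here : ∀ {v} → Walk E v v zero
  step : ∀ {u v w k} → E u v → Walk E v w k → Walk E u w (suc k)

DistLe : ∀ {n} (E : Graph n) → Fin n → Fin n → ℕ → Set
DistLe E v w s = ∃[ k ] (Walk E v w k × k ℕ.≤ s)

Connected : ∀ {n} → Graph n → Set
Connected E = ∀ v w → ∃[ k ] Walk E v w k

N[_,_,_] : ∀ {n} → Graph n → ℕ → Fin n → Fin n → Set
N[ E , s , v ] w = DistLe E v w s

ℕ→ℚ : ℕ → ℚ
ℕ→ℚ k = + k / 1

-- Points of the geometric realisation of G: vertices, and interior points of
-- edges: (v , w , e , t) is the point at distance t from v along edge vw,
-- 0 < t < 1.  (Parameters t are taken rational.)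
data Point {n : ℕ} (E : Graph n) : Set where
  vtx  : Fin n → Point E
  onEdge : (v w : Fin n) → E v w → (t : ℚ) → 0ℚ ℚ.< t → t ℚ.< 1ℚ → Point E

-- The vertex u lies in the closed ball of radius r/2 about the point x,
-- i.e. d(u,x) ≤ r/2, i.e. 2·d(u,x) ≤ r, with the shortest-path metric of the
-- geometric realisation (a path from u to an interior point of edge vw
-- enters through v or through w).
InHalfBall : ∀ {n} (E : Graph n) → ℕ → Point E → Fin n → Set
InHalfBall E r (vtx v) u = ∃[ k ] (Walk E u v k × 2 ℕ.* k ℕ.≤ r)
InHalfBall E r (onEdge v w _ t _ _) u =
    (∃[ k ] (Walk E u v k × ℕ→ℚ 2 ℚ.* (ℕ→ℚ k ℚ.+ t) ℚ.≤ ℕ→ℚ r))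
  ⊎ (∃[ k ] (Walk E u w k × ℕ→ℚ 2 ℚ.* (ℕ→ℚ k ℚ.+ (1ℚ - t)) ℚ.≤ ℕ→ℚ r))

Nonempty : ∀ {n} → Subset n → Set
Nonempty {n} σ = ∃[ v ] (v ∈ σ)

-- σ is a simplex of the Čech complex 𝒩(G,r): σ nonempty and the closed balls
-- of radius r/2 about the vertices of σ have a common point.
IsCechSimplex : ∀ {n} (E : Graph n) → ℕ → Subset n → Set
IsCechSimplex E r σ = Nonempty σ × ∃[ x ] (∀ u → u ∈ σ → InHalfBall E r x u)

_⊆ₚ_ : ∀ {n} → Subset n → (Fin n → Set) → Set
σ ⊆ₚ P = ∀ u → u ∈ σ → P u

{-# OPTIONS --safe #-}
-- A path from u to an interior point of an edge vw leaves the vertex set through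
-- v or w at some distance k, and then 2k < r.  For r = 2m this puts u within m
-- of v (through w it costs one step more), so edge points add no simplices; for
-- r = 2m + 1 it puts u within m of v or of w, and conversely the midpoint of vw
-- is a common point for all of N_m[v] ∪ N_m[w].  A vertex centre in the odd case
-- gives σ ⊆ N_m[v] ⊆ N_m[v] ∪ N_m[w] for any neighbour w of v, which exists by
-- connectivity unless v is the only vertex, and then σ is the singleton {v}.

module Submission where

open import Defs
open import Data.Nat as ℕ using (ℕ; zero; suc; _*_; _≤_; _<_; s≤s; z≤n)
import Data.Nat.Properties as ℕₚ
open import Data.Nat.Coprimality using (1-coprimeTo) renaming (sym to coprime-sym)
open import Data.Integer as ℤ using (+_)
import Data.Integer.Properties as ℤₚ
open import Data.Rational as ℚ using (mkℚ; ½; 0ℚ; 1ℚ; *≤*; *<*)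
import Data.Rational.Properties as ℚₚ
open import Data.Fin using (Fin; zero; suc)
open import Data.Fin.Subset using (Subset; ⁅_⁆; _∈_)
open import Data.Fin.Subset.Properties using (⊆-antisym; x∈⁅x⁆; x∈⁅y⁆⇒x≡y)
open import Data.Product using (_×_; _,_; ∃-syntax)
open import Data.Sum using (_⊎_; inj₁; inj₂)
open import Function.Bundles using (_⇔_; mk⇔; Equivalence)
open import Relation.Binary.Definitions using (Symmetric)
open import Relation.Binary.PropositionalEquality
  using (_≡_; refl; sym; trans; cong; cong₂; subst; subst₂)

ℕ→ℚ≡mkℚ : ∀ k → ℕ→ℚ k ≡ mkℚ (+ k) 0 (coprime-sym (1-coprimeTo k))
ℕ→ℚ≡mkℚ k = ℚₚ.normalize-coprime (coprime-sym (1-coprimeTo k))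

ℕ→ℚ-homo-+ : ∀ a b → ℕ→ℚ (a ℕ.+ b) ≡ ℕ→ℚ a ℚ.+ ℕ→ℚ b
ℕ→ℚ-homo-+ a b rewrite ℕ→ℚ≡mkℚ a | ℕ→ℚ≡mkℚ b =
  cong (ℚ._/ 1) (trans (ℤₚ.pos-+ a b) (sym (cong₂ ℤ._+_ (ℤₚ.*-identityʳ (+ a)) (ℤₚ.*-identityʳ (+ b)))))

ℕ→ℚ-homo-* : ∀ a b → ℕ→ℚ (a * b) ≡ ℕ→ℚ a ℚ.* ℕ→ℚ b
ℕ→ℚ-homo-* a b rewrite ℕ→ℚ≡mkℚ a | ℕ→ℚ≡mkℚ b = cong (ℚ._/ 1) (ℤₚ.pos-* a b)

ℕ→ℚ-mono-≤ : ∀ {a b} → a ≤ b → ℕ→ℚ a ℚ.≤ ℕ→ℚ b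
ℕ→ℚ-mono-≤ {a} {b} a≤b rewrite ℕ→ℚ≡mkℚ a | ℕ→ℚ≡mkℚ b =
  *≤* (subst₂ ℤ._≤_ (sym (ℤₚ.*-identityʳ (+ a))) (sym (ℤₚ.*-identityʳ (+ b))) (ℤ.+≤+ a≤b))

ℕ→ℚ-cancel-< : ∀ {a b} → ℕ→ℚ a ℚ.< ℕ→ℚ b → a < b
ℕ→ℚ-cancel-< {a} {b} a<b rewrite ℕ→ℚ≡mkℚ a | ℕ→ℚ≡mkℚ b with a<b
... | *<* a<b′ = ℤₚ.drop‿+<+ (subst₂ ℤ._<_ (ℤₚ.*-identityʳ (+ a)) (ℤₚ.*-identityʳ (+ b)) a<b′)

2[k+t]≤r⇒2k<r : ∀ k r {t} → 0ℚ ℚ.< t → ℕ→ℚ 2 ℚ.* (ℕ→ℚ k ℚ.+ t) ℚ.≤ ℕ→ℚ r → 2 * k < r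
2[k+t]≤r⇒2k<r k r {t} 0<t 2[k+t]≤r = ℕ→ℚ-cancel-< (begin-strict
  ℕ→ℚ (2 * k)                ≡⟨ ℕ→ℚ-homo-* 2 k ⟩
  ℕ→ℚ 2 ℚ.* ℕ→ℚ k            ≡⟨ cong (ℕ→ℚ 2 ℚ.*_) (ℚₚ.+-identityʳ (ℕ→ℚ k)) ⟨
  ℕ→ℚ 2 ℚ.* (ℕ→ℚ k ℚ.+ 0ℚ)  <⟨ ℚₚ.*-monoʳ-<-pos (ℕ→ℚ 2) (ℚₚ.+-monoʳ-< (ℕ→ℚ k) 0<t) ⟩
  ℕ→ℚ 2 ℚ.* (ℕ→ℚ k ℚ.+ t)   ≤⟨ 2[k+t]≤r ⟩
  ℕ→ℚ r                      ∎)
  where open ℚₚ.≤-Reasoning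

2[k+½]≤1+2m : ∀ {k m} → k ≤ m → ℕ→ℚ 2 ℚ.* (ℕ→ℚ k ℚ.+ ½) ℚ.≤ ℕ→ℚ (suc (2 * m))
2[k+½]≤1+2m {k} {m} k≤m = begin
  ℕ→ℚ 2 ℚ.* (ℕ→ℚ k ℚ.+ ½)          ≡⟨ ℚₚ.*-distribˡ-+ (ℕ→ℚ 2) (ℕ→ℚ k) ½ ⟩
  ℕ→ℚ 2 ℚ.* ℕ→ℚ k ℚ.+ ℕ→ℚ 1        ≡⟨ cong (ℚ._+ ℕ→ℚ 1) (ℕ→ℚ-homo-* 2 k) ⟨
  ℕ→ℚ (2 * k) ℚ.+ ℕ→ℚ 1            ≡⟨ ℕ→ℚ-homo-+ (2 * k) 1 ⟨
  ℕ→ℚ (2 * k ℕ.+ 1)                ≡⟨ cong ℕ→ℚ (ℕₚ.+-comm (2 * k) 1) ⟩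
  ℕ→ℚ (suc (2 * k))                ≤⟨ ℕ→ℚ-mono-≤ (s≤s (ℕₚ.*-monoʳ-≤ 2 k≤m)) ⟩
  ℕ→ℚ (suc (2 * m))                ∎
  where open ℚₚ.≤-Reasoning

0<1-t : ∀ {t} → t ℚ.< 1ℚ → 0ℚ ℚ.< 1ℚ ℚ.- t
0<1-t {t} t<1 = subst (ℚ._< 1ℚ ℚ.- t) (ℚₚ.+-inverseʳ t) (ℚₚ.+-monoˡ-< (ℚ.- t) t<1)

0<½ : 0ℚ ℚ.< ½
0<½ = *<* (ℤ.+<+ (s≤s z≤n))

½<1 : ½ ℚ.< 1ℚ
½<1 = *<* (ℤ.+<+ (s≤s (s≤s z≤n)))

2k≤1+2m⇒k≤m : ∀ {k m} → 2 * k ≤ suc (2 * m) → k ≤ m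
2k≤1+2m⇒k≤m {k} {m} 2k≤1+2m =
  ℕₚ.≤-pred (ℕₚ.*-cancelˡ-< 2 k (suc m) (subst (2 * k <_) (sym (ℕₚ.*-suc 2 m)) (s≤s 2k≤1+2m)))

nonempty⇒≡⁅x⁆ : ∀ {n} {x : Fin n} {σ : Subset n} → (∀ y → y ≡ x) → Nonempty σ → σ ≡ ⁅ x ⁆
nonempty⇒≡⁅x⁆ {x = x} {σ} all≡x (y , y∈σ) = ⊆-antisym
  (λ {z} _ → subst (_∈ ⁅ x ⁆) (sym (all≡x z)) (x∈⁅x⁆ x))
  (λ {z} _ → subst (_∈ σ) (trans (all≡x y) (sym (all≡x z))) y∈σ)

sole-vertex-or-neighbour : ∀ {n} {E : Graph n} → Connected E → (v : Fin n) →
  (∀ u → u ≡ v) ⊎ ∃[ w ] E v w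
sole-vertex-or-neighbour {suc zero}    conn zero = inj₁ λ { zero → refl }
sole-vertex-or-neighbour {suc (suc _)} conn zero with conn zero (suc zero)
... | _ , step e _ = inj₂ (_ , e)
sole-vertex-or-neighbour {suc (suc _)} conn (suc v) with conn (suc v) zero
... | _ , step e _ = inj₂ (_ , e)

module _ {n : ℕ} {E : Graph n} where

  _∷ʳ_ : ∀ {u v w k} → Walk E u v k → E v w → Walk E u w (suc k)
  here     ∷ʳ e = step e here
  step d p ∷ʳ e = step d (p ∷ʳ e)

  ⁅v⁆-isCechSimplex : ∀ {r} v → IsCechSimplex E r ⁅ v ⁆
  ⁅v⁆-isCechSimplex v = (v , x∈⁅x⁆ v) , vtx v , λ u u∈⁅v⁆ → ball-centre (x∈⁅y⁆⇒x≡y v u∈⁅v⁆)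
    where
    ball-centre : ∀ {r u} → u ≡ v → InHalfBall E r (vtx v) u
    ball-centre refl = 0 , here , z≤n

SingletonOrNearEdge : ∀ {n} → Graph n → ℕ → Subset n → Set
SingletonOrNearEdge E m σ =
  (∃[ v ] σ ≡ ⁅ v ⁆) ⊎ (∃[ v ] ∃[ w ] (E v w × σ ⊆ₚ (λ u → N[ E , m , v ] u ⊎ N[ E , m , w ] u)))

module _ {n : ℕ} {E : Graph n} (E-sym : Symmetric E) where

  reverse : ∀ {u v k} → Walk E u v k → Walk E v u k
  reverse here       = here
  reverse (step e p) = reverse p ∷ʳ E-sym e

  walk⇒N : ∀ {s u v k} → Walk E u v k → k ≤ s → N[ E , s , v ] u
  walk⇒N p k≤s = _ , reverse p , k≤s

  vertex-ball-even⇔N : ∀ {m u v} → InHalfBall E (2 * m) (vtx v) u ⇔ N[ E , m , v ] u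
  vertex-ball-even⇔N = mk⇔ (λ (k , p , 2k≤2m) → walk⇒N p (ℕₚ.*-cancelˡ-≤ 2 2k≤2m))
                           (λ (k , p , k≤m) → k , reverse p , ℕₚ.*-monoʳ-≤ 2 k≤m)

  vertex-ball-odd⇒N : ∀ {m u v} → InHalfBall E (suc (2 * m)) (vtx v) u → N[ E , m , v ] u
  vertex-ball-odd⇒N (k , p , 2k≤1+2m) = walk⇒N p (2k≤1+2m⇒k≤m 2k≤1+2m)

  edge-ball-even⇒N : ∀ {m u v w t} (e : E v w) (0<t : 0ℚ ℚ.< t) (t<1 : t ℚ.< 1ℚ) →
    InHalfBall E (2 * m) (onEdge v w e t 0<t t<1) u → N[ E , m , v ] u
  edge-ball-even⇒N {m} _ 0<t _ (inj₁ (k , p , h)) =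
    walk⇒N p (ℕₚ.<⇒≤ (ℕₚ.*-cancelˡ-< 2 k m (2[k+t]≤r⇒2k<r k _ 0<t h)))
  edge-ball-even⇒N {m} e _ t<1 (inj₂ (k , p , h)) =
    walk⇒N (p ∷ʳ E-sym e) (ℕₚ.*-cancelˡ-< 2 k m (2[k+t]≤r⇒2k<r k _ (0<1-t t<1) h))

  edge-ball-odd⇒N : ∀ {m u v w t} (e : E v w) (0<t : 0ℚ ℚ.< t) (t<1 : t ℚ.< 1ℚ) →
    InHalfBall E (suc (2 * m)) (onEdge v w e t 0<t t<1) u → N[ E , m , v ] u ⊎ N[ E , m , w ] u
  edge-ball-odd⇒N {m} _ 0<t _ (inj₁ (k , p , h)) =
    inj₁ (walk⇒N p (2k≤1+2m⇒k≤m (ℕₚ.<⇒≤ (2[k+t]≤r⇒2k<r k (suc (2 * m)) 0<t h))))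
  edge-ball-odd⇒N {m} _ _ t<1 (inj₂ (k , p , h)) =
    inj₂ (walk⇒N p (2k≤1+2m⇒k≤m (ℕₚ.<⇒≤ (2[k+t]≤r⇒2k<r k (suc (2 * m)) (0<1-t t<1) h))))

  N⇒midpoint-ball : ∀ {m u v w} (e : E v w) →
    N[ E , m , v ] u ⊎ N[ E , m , w ] u → InHalfBall E (suc (2 * m)) (onEdge v w e ½ 0<½ ½<1) u
  N⇒midpoint-ball _ (inj₁ (k , p , k≤m)) = inj₁ (k , reverse p , 2[k+½]≤1+2m k≤m)
  N⇒midpoint-ball _ (inj₂ (k , p , k≤m)) = inj₂ (k , reverse p , 2[k+½]≤1+2m k≤m)

  isCechSimplex-even⇔ : ∀ m {σ} → Nonempty σ →
    IsCechSimplex E (2 * m) σ ⇔ (∃[ v ] σ ⊆ₚ N[ E , m , v ])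
  isCechSimplex-even⇔ m {σ} σ≢∅ = mk⇔ to from
    where
    to : IsCechSimplex E (2 * m) σ → ∃[ v ] σ ⊆ₚ N[ E , m , v ]
    to (_ , vtx v , balls) = v , λ u u∈σ → Equivalence.to vertex-ball-even⇔N (balls u u∈σ)
    to (_ , onEdge v _ e _ 0<t t<1 , balls) =
      v , λ u u∈σ → edge-ball-even⇒N e 0<t t<1 (balls u u∈σ)

    from : ∃[ v ] σ ⊆ₚ N[ E , m , v ] → IsCechSimplex E (2 * m) σ
    from (v , σ⊆N) = σ≢∅ , vtx v , λ u u∈σ → Equivalence.from vertex-ball-even⇔N (σ⊆N u u∈σ)

  isCechSimplex-odd⇔ : Connected E → ∀ m {σ} → Nonempty σ →
    IsCechSimplex E (suc (2 * m)) σ ⇔ SingletonOrNearEdge E m σ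
  isCechSimplex-odd⇔ conn m {σ} σ≢∅ = mk⇔ to from
    where
    to : IsCechSimplex E (suc (2 * m)) σ → SingletonOrNearEdge E m σ
    to (_ , vtx v , balls) with sole-vertex-or-neighbour conn v
    ... | inj₁ all≡v = inj₁ (v , nonempty⇒≡⁅x⁆ all≡v σ≢∅)
    ... | inj₂ (w , e) = inj₂ (v , w , e , λ u u∈σ → inj₁ (vertex-ball-odd⇒N (balls u u∈σ)))
    to (_ , onEdge v w e _ 0<t t<1 , balls) =
      inj₂ (v , w , e , λ u u∈σ → edge-ball-odd⇒N e 0<t t<1 (balls u u∈σ))

    from : SingletonOrNearEdge E m σ → IsCechSimplex E (suc (2 * m)) σ
    from (inj₁ (v , refl)) = ⁅v⁆-isCechSimplex v
    from (inj₂ (v , w , e , σ⊆N∪N)) =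
      σ≢∅ , onEdge v w e ½ 0<½ ½<1 , λ u u∈σ → N⇒midpoint-ball e (σ⊆N∪N u u∈σ)

lemma2p2 : (n : ℕ) (E : Graph n) → IsSimple E → Connected E → (r : ℕ) →
    ((v : Fin n) → IsCechSimplex E r ⁅ v ⁆)
    × ((m : ℕ) → r ≡ 2 * m → (σ : Subset n) → Nonempty σ →
        (IsCechSimplex E r σ ⇔ (∃[ v ] (σ ⊆ₚ N[ E , m , v ]))))
    × ((m : ℕ) → r ≡ suc (2 * m) → (σ : Subset n) → Nonempty σ →
        (IsCechSimplex E r σ ⇔
          ((∃[ v ] (σ ≡ ⁅ v ⁆))
           ⊎ (∃[ v ] ∃[ w ] (E v w × σ ⊆ₚ (λ u → N[ E , m , v ] u ⊎ N[ E , m , w ] u))))))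
lemma2p2 n E simple conn r =
    ⁅v⁆-isCechSimplex
  , (λ { m refl _ → isCechSimplex-even⇔ E-sym m })
  , (λ { m refl _ → isCechSimplex-odd⇔ E-sym conn m })
  where open IsSimple simple using () renaming (sym to E-sym)
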